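{- Let $k$ be a positive integer and let $G_k$ be a graph that has no packing $(1^2,2^k)$-coloring but every proper subgraph of which has a packing $(1^2,2^k)$-coloring. Suppose $u_1u_2$ is an edge of $G_k$ with $\deg(u_1)=\deg(u_2)=2$, and for $i\in\{1,2\}$ let $v_i$ be the neighbor of $u_i$ other than $u_{3-i}$. Then both $v_1$ and $v_2$ have degree at least $k+2$.
   Context: All graphs are finite and simple. A set of vertices is $i$-independent if any two distinct vertices in it are at distance at least $i+1$. A packing $(1^{\ell},2^{k})$-coloring of $G$ is a partition of $V(G)$ into $\ell$ independent sets and $k$ $2$-independent sets (some parts may be empty). -}

module Defs where

open import Data.Nat using (ℕ; zero; suc; _≤_; _+_)
open import Data.Fin using (Fin)
open import Data.Bool using (Bool; true; false; if_then_else_)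
open import Data.List using (map; allFin)
open import Data.Nat.ListAction using (sum)
open import Data.Sum using (_⊎_; inj₁; inj₂)
open import Data.Product using (Σ; _×_; ∃-syntax)
open import Relation.Binary.PropositionalEquality using (_≡_; _≢_)
open import Relation.Nullary using (¬_)
open import Function.Definitions using (Injective)

record Graph : Set where
  field
    n     : ℕ
    adj   : Fin n → Fin n → Bool
    sym   : ∀ u v → adj u v ≡ adj v u
    irrefl : ∀ v → adj v v ≡ false
open Graph public

Vertex : Graph → Set
Vertex G = Fin (n G)

Adj : (G : Graph) → Vertex G → Vertex G → Set
Adj G u v = adj G u v ≡ true

deg : (G : Graph) → Vertex G → ℕ
deg G v = sum (map (λ w → if adj G v w then 1 else 0) (allFin (n G)))

data Walk (G : Graph) : Vertex G → Vertex G → ℕ → Set where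
  here : ∀ {u} → Walk G u u 0
  step : ∀ {u w v l} → Adj G u w → Walk G w v l → Walk G u v (suc l)

-- dist(u,v) ≥ i+1  iff  there is no walk from u to v of length ≤ i
DistAtLeastSuc : (G : Graph) → ℕ → Vertex G → Vertex G → Set
DistAtLeastSuc G i u v = ∀ l → l ≤ i → ¬ Walk G u v l

-- a packing (1^ℓ, 2^k)-colouring: colour classes inj₁ _ are independent
-- (1-independent), colour classes inj₂ _ are 2-independent.
IsPackingColoring : (G : Graph) (ℓ k : ℕ) → (Vertex G → Fin ℓ ⊎ Fin k) → Set
IsPackingColoring G ℓ k c =
  (∀ u v (a : Fin ℓ) → c u ≡ inj₁ a → c v ≡ inj₁ a → u ≢ v → DistAtLeastSuc G 1 u v) ×
  (∀ u v (b : Fin k) → c u ≡ inj₂ b → c v ≡ inj₂ b → u ≢ v → DistAtLeastSuc G 2 u v)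

HasPackingColoring : Graph → ℕ → ℕ → Set
HasPackingColoring G ℓ k = Σ (Vertex G → Fin ℓ ⊎ Fin k) (IsPackingColoring G ℓ k)

IsSubgraphVia : (H G : Graph) → (Vertex H → Vertex G) → Set
IsSubgraphVia H G f = Injective _≡_ _≡_ f × (∀ x y → Adj H x y → Adj G (f x) (f y))

ProperVia : (H G : Graph) → (Vertex H → Vertex G) → Set
ProperVia H G f =
  (∃[ v ] (∀ x → f x ≢ v)) ⊎ (∃[ x ] ∃[ y ] (Adj G (f x) (f y) × adj H x y ≡ false))

IsProperSubgraph : Graph → Graph → Set
IsProperSubgraph H G = Σ (Vertex H → Vertex G) (λ f → IsSubgraphVia H G f × ProperVia H G f)

module Submission where

-- By minimality, G − u₁u₂ has a packing colouring c; since G has none, no way of recolouring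
-- u₁ and u₂ (which only see each other and v₁, v₂) may succeed.  Two distinct 1-colours
-- avoiding c(v₁) and c(v₂) exist unless v₁ and v₂ share a 1-colour b.  In that case u₁
-- could take any 2-colour missing from N(v₁) − u₁, and u₂ could keep a 2-colour it already
-- has; so every 2-colour occurs on N(v₁) − u₁.  If moreover some vertex of N(v₁) − u₁ has a
-- 1-colour, then |N(v₁)| ≥ k + 2; if none has, v₁ can switch to the other 1-colour, which
-- again makes G colourable.  Reversing the path v₁u₁u₂v₂ gives the bound for v₂.

open import Defs hiding (sym)
open import Data.Bool using (Bool; true; false; not; _∧_; if_then_else_)
open import Data.Bool.Properties using (∧-zeroʳ) renaming (_≟_ to _≟ᵇ_)
open import Data.Empty using (⊥; ⊥-elim)
open import Data.Fin using (Fin; zero; suc; punchIn; punchOut; _≟_)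
open import Data.Fin.Properties
  using (any?; all?; ¬∀⟶∃¬; injective⇒≤; punchIn-injective; punchInᵢ≢i; punchOut-injective; punchIn-punchOut)
open import Data.List using (tabulate)
open import Data.List.Properties using (map-tabulate)
open import Data.Nat using (ℕ; zero; suc; _≤_; _+_; z≤n; s≤s)
open import Data.Nat.ListAction using (sum)
open import Data.Nat.Properties using (≤-trans; ≤-refl; m≤n+m; +-comm)
open import Data.Product using (_×_; _,_; ∃; ∃₂; proj₁; proj₂; uncurry)
import Data.Product as Product
open import Data.Sum using (_⊎_; inj₁; inj₂)
import Data.Sum as Sum
open import Data.Sum.Properties using (≡-dec; inj₁-injective; inj₂-injective)
open import Data.Vec.Functional using (_∷_; []; updateAt)
open import Data.Vec.Functional.Properties using (updateAt-updates; updateAt-minimal)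
open import Function using (_∘_; id; const; flip)
open import Function.Bundles using (mk⇔)
open import Function.Definitions using (Injective)
open import Relation.Binary.PropositionalEquality using (_≡_; _≢_; refl; sym; trans; cong; cong₂; subst)
open import Relation.Nullary using (¬_; Dec; does; yes; no; contradiction)
open import Relation.Nullary.Decidable using (dec-true; dec-false; does-⇔; _×-dec_; _⊎-dec_; ¬?)

countTrue : ∀ {m} → (Fin m → Bool) → ℕ
countTrue f = sum (tabulate (λ i → if f i then 1 else 0))

injective⇒≤countTrue : ∀ {m l} (f : Fin m → Bool) (h : Fin l → Fin m) →
                       Injective _≡_ _≡_ h → (∀ i → f (h i) ≡ true) → l ≤ countTrue f
injective⇒≤countTrue {zero} f h h-inj _ = injective⇒≤ h-inj
injective⇒≤countTrue {suc m} {zero} f h h-inj fh = z≤n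
injective⇒≤countTrue {suc m} {suc l} f h h-inj fh = byHittingZero (any? (λ i → h i ≟ zero))
  where
  avoidingZero : ∀ {l′} (g : Fin l′ → Fin (suc m)) → Injective _≡_ _≡_ g →
                 (∀ i → zero ≢ g i) → (∀ i → f (g i) ≡ true) → l′ ≤ countTrue (f ∘ suc)
  avoidingZero g g-inj g≢0 fg =
    injective⇒≤countTrue (f ∘ suc) (λ i → punchOut (g≢0 i))
      (λ eq → g-inj (punchOut-injective (g≢0 _) (g≢0 _) eq))
      (λ i → trans (cong f (punchIn-punchOut (g≢0 i))) (fg i))

  byHittingZero : Dec (∃ λ i → h i ≡ zero) → suc l ≤ countTrue f
  byHittingZero (no h≢0) =
    ≤-trans (avoidingZero h h-inj (λ i eq → h≢0 (i , sym eq)) fh) (m≤n+m _ _)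
  byHittingZero (yes (i₀ , hi₀≡0)) rewrite trans (cong f (sym hi₀≡0)) (fh i₀) =
    s≤s (avoidingZero (h ∘ punchIn i₀) (punchIn-injective i₀ _ _ ∘ h-inj)
           (λ j eq → punchInᵢ≢i i₀ j (h-inj (trans (sym eq) (sym hi₀≡0))))
           (fh ∘ punchIn i₀))

∷-injective : ∀ {A : Set} {l} {x : A} {xs : Fin l → A} →
              (∀ i → x ≢ xs i) → Injective _≡_ _≡_ xs → Injective _≡_ _≡_ (x ∷ xs)
∷-injective x∉xs xs-inj {zero}  {zero}  _  = refl
∷-injective x∉xs xs-inj {zero}  {suc j} eq = ⊥-elim (x∉xs j eq)
∷-injective x∉xs xs-inj {suc i} {zero}  eq = ⊥-elim (x∉xs i (sym eq))
∷-injective x∉xs xs-inj {suc i} {suc j} eq = cong suc (xs-inj eq)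

module _ (G : Graph) where

  adj-sym : ∀ {x y} → Adj G x y → Adj G y x
  adj-sym {x} {y} xy = trans (Graph.sym G y x) xy

  adj⇒≢ : ∀ {x y} → Adj G x y → x ≢ y
  adj⇒≢ {x} xx refl with trans (sym (irrefl G x)) xx
  ... | ()

  deg≡countTrue : ∀ v → deg G v ≡ countTrue (adj G v)
  deg≡countTrue v = cong sum (map-tabulate id (λ w → if adj G v w then 1 else 0))

  injective⇒≤deg : ∀ {l} v (h : Fin l → Vertex G) →
                   Injective _≡_ _≡_ h → (∀ i → Adj G v (h i)) → l ≤ deg G v
  injective⇒≤deg v h h-inj vh =
    subst (_ ≤_) (sym (deg≡countTrue v)) (injective⇒≤countTrue (adj G v) h h-inj vh)

  deg≡2⇒neighbour : ∀ {u a b w} → deg G u ≡ 2 → Adj G u a → Adj G u b → a ≢ b →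
                    Adj G u w → w ≡ a ⊎ w ≡ b
  deg≡2⇒neighbour {u} {a} {b} {w} deg≡2 ua ub a≢b uw with w ≟ a | w ≟ b
  ... | yes w≡a | _       = inj₁ w≡a
  ... | no _    | yes w≡b = inj₂ w≡b
  ... | no w≢a  | no w≢b  = contradiction three≤2 λ { (s≤s (s≤s ())) }
    where
    three≤2 : 3 ≤ 2
    three≤2 = subst (3 ≤_) deg≡2 (injective⇒≤deg u (a ∷ b ∷ w ∷ [])
      (∷-injective (λ { zero → a≢b ; (suc zero) → w≢a ∘ sym ; (suc (suc ())) })
        (∷-injective (λ { zero → w≢b ∘ sym ; (suc ()) }) (∷-injective (λ ()) λ { {()} })))
      λ { zero → ua ; (suc zero) → ub ; (suc (suc zero)) → uw })

  deg≡2⇒≡ : ∀ {u a b x y} → deg G u ≡ 2 → Adj G u a → Adj G u b → a ≢ b →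
            Adj G u x → Adj G u y → x ≢ a → y ≢ a → x ≡ y
  deg≡2⇒≡ {x = x} {y} deg≡2 ua ub a≢b ux uy x≢a y≢a
    with deg≡2⇒neighbour {w = x} deg≡2 ua ub a≢b ux | deg≡2⇒neighbour {w = y} deg≡2 ua ub a≢b uy
  ... | inj₁ x≡a | _        = ⊥-elim (x≢a x≡a)
  ... | _        | inj₁ y≡a = ⊥-elim (y≢a y≡a)
  ... | inj₂ x≡b | inj₂ y≡b = trans x≡b (sym y≡b)

Colouring : Graph → ℕ → ℕ → Set
Colouring G ℓ k = Vertex G → Fin ℓ ⊎ Fin k

module _ (G : Graph) {ℓ k : ℕ} where

  data Conflict (c : Colouring G ℓ k) (x y : Vertex G) : Set where
    adjacent        : Adj G x y → c x ≡ c y → Conflict c x y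
    commonNeighbour : ∀ {w β} → x ≢ y → Adj G x w → Adj G w y →
                      c x ≡ inj₂ β → c y ≡ inj₂ β → Conflict c x y

  ConflictFree : Colouring G ℓ k → Set
  ConflictFree c = ∀ x y → ¬ Conflict c x y

module _ {G : Graph} {ℓ k : ℕ} where

  conflict-sym : ∀ {c : Colouring G ℓ k} {x y} → Conflict G c x y → Conflict G c y x
  conflict-sym (adjacent xy eq) = adjacent (adj-sym G xy) (sym eq)
  conflict-sym (commonNeighbour x≢y xw wy cx cy) =
    commonNeighbour (x≢y ∘ sym) (adj-sym G wy) (adj-sym G xw) cy cx

  conflictFree⇒packing : ∀ {c : Colouring G ℓ k} → ConflictFree G c → IsPackingColoring G ℓ k c
  conflictFree⇒packing {c} free = first , second
    where
    first : ∀ u v a → c u ≡ inj₁ a → c v ≡ inj₁ a → u ≢ v → DistAtLeastSuc G 1 u v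
    first u v a cu cv u≢v _ _ here           = u≢v refl
    first u v a cu cv u≢v _ _ (step uv here) = free u v (adjacent uv (trans cu (sym cv)))
    first u v a cu cv u≢v _ (s≤s ()) (step _ (step _ _))

    second : ∀ u v β → c u ≡ inj₂ β → c v ≡ inj₂ β → u ≢ v → DistAtLeastSuc G 2 u v
    second u v β cu cv u≢v _ _ here                     = u≢v refl
    second u v β cu cv u≢v _ _ (step uv here)           = free u v (adjacent uv (trans cu (sym cv)))
    second u v β cu cv u≢v _ _ (step uw (step wv here)) = free u v (commonNeighbour u≢v uw wv cu cv)
    second u v β cu cv u≢v _ (s≤s (s≤s ())) (step _ (step _ (step _ _)))

  packing⇒conflictFree : ∀ {c : Colouring G ℓ k} → IsPackingColoring G ℓ k c → ConflictFree G c
  packing⇒conflictFree {c} (first , second) x y (adjacent xy cx≡cy) with c x in cx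
  ... | inj₁ a = first  x y a cx (sym cx≡cy) (adj⇒≢ G xy) 1 (s≤s z≤n) (step xy here)
  ... | inj₂ β = second x y β cx (sym cx≡cy) (adj⇒≢ G xy) 1 (s≤s z≤n) (step xy here)
  packing⇒conflictFree (first , second) x y (commonNeighbour x≢y xw wy cx cy) =
    second x y _ cx cy x≢y 2 ≤-refl (step xw (step wy here))

  conflictFree-recolour₁ : ∀ {c c′ : Colouring G ℓ k} → ConflictFree G c →
    (∀ x {β} → c′ x ≡ inj₂ β → c x ≡ inj₂ β) →
    (∀ x y → c′ x ≢ c x → Adj G x y → c′ x ≢ c′ y) →
    ConflictFree G c′
  conflictFree-recolour₁ {c} {c′} free keeps₂ changed x y (adjacent xy c′x≡c′y)
    with ≡-dec _≟_ _≟_ (c′ x) (c x) | ≡-dec _≟_ _≟_ (c′ y) (c y)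
  ... | no moved | _        = changed x y moved xy c′x≡c′y
  ... | _        | no moved = changed y x moved (adj-sym G xy) (sym c′x≡c′y)
  ... | yes same | yes same′ = free x y (adjacent xy (trans (sym same) (trans c′x≡c′y same′)))
  conflictFree-recolour₁ free keeps₂ changed x y (commonNeighbour x≢y xw wy cx cy) =
    free x y (commonNeighbour x≢y xw wy (keeps₂ x cx) (keeps₂ y cy))

SamePair : ∀ {A : Set} → A → A → A → A → Set
SamePair u v x y = (x ≡ u × y ≡ v) ⊎ (x ≡ v × y ≡ u)

samePair-swap : ∀ {A : Set} {u v x y : A} → SamePair u v x y → SamePair u v y x
samePair-swap = Sum.swap ∘ Sum.map Product.swap Product.swap

samePair? : ∀ {m} (u v x y : Fin m) → Dec (SamePair u v x y)
samePair? u v x y = (x ≟ u ×-dec y ≟ v) ⊎-dec (x ≟ v ×-dec y ≟ u)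

removeEdge : (G : Graph) → Vertex G → Vertex G → Graph
removeEdge G u v = record
  { n      = n G
  ; adj    = λ x y → adj G x y ∧ not (does (samePair? u v x y))
  ; sym    = λ x y → cong₂ (λ a b → a ∧ not b) (Graph.sym G x y)
                       (does-⇔ (mk⇔ samePair-swap samePair-swap) (samePair? u v x y) (samePair? u v y x))
  ; irrefl = λ x → cong (_∧ _) (irrefl G x)
  }

module _ {G : Graph} {u v : Vertex G} where

  removeEdge-⊆ : ∀ {x y} → Adj (removeEdge G u v) x y → Adj G x y
  removeEdge-⊆ {x} {y} xy with adj G x y
  ... | true = refl

  removeEdge-keeps : ∀ {x y} → Adj G x y → ¬ SamePair u v x y → Adj (removeEdge G u v) x y
  removeEdge-keeps {x} {y} xy ¬uv rewrite xy | dec-false (samePair? u v x y) ¬uv = refl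

  removeEdge-removes : adj (removeEdge G u v) u v ≡ false
  removeEdge-removes rewrite dec-true (samePair? u v u v) (inj₁ (refl , refl)) = ∧-zeroʳ (adj G u v)

  removeEdge-proper : Adj G u v → IsProperSubgraph (removeEdge G u v) G
  removeEdge-proper uv = id , (id , λ _ _ → removeEdge-⊆) , inj₂ (u , v , uv , removeEdge-removes)

record Thread (G : Graph) : Set where
  field
    u₁ u₂ v₁ v₂ : Vertex G
    u₁~u₂  : Adj G u₁ u₂
    u₁~v₁  : Adj G u₁ v₁
    u₂~v₂  : Adj G u₂ v₂
    v₁≢u₂  : v₁ ≢ u₂
    v₂≢u₁  : v₂ ≢ u₁
    deg-u₁ : deg G u₁ ≡ 2
    deg-u₂ : deg G u₂ ≡ 2

  G′ : Graph
  G′ = removeEdge G u₁ u₂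

  u₁≢u₂ : u₁ ≢ u₂
  u₁≢u₂ = adj⇒≢ G u₁~u₂

  v₁≢u₁ : v₁ ≢ u₁
  v₁≢u₁ = adj⇒≢ G u₁~v₁ ∘ sym

  v₂≢u₂ : v₂ ≢ u₂
  v₂≢u₂ = adj⇒≢ G u₂~v₂ ∘ sym

  neighbour-u₁ : ∀ w → Adj G u₁ w → w ≡ u₂ ⊎ w ≡ v₁
  neighbour-u₁ _ = deg≡2⇒neighbour G deg-u₁ u₁~u₂ u₁~v₁ (v₁≢u₂ ∘ sym)

  neighbour-u₂ : ∀ w → Adj G u₂ w → w ≡ u₁ ⊎ w ≡ v₂
  neighbour-u₂ _ = deg≡2⇒neighbour G deg-u₂ (adj-sym G u₁~u₂) u₂~v₂ (v₂≢u₁ ∘ sym)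

  G′⊆G : ∀ {x y} → Adj G′ x y → Adj G x y
  G′⊆G = removeEdge-⊆ {G = G} {u₁} {u₂}

  neighbour′-u₁ : ∀ y → Adj G′ u₁ y → y ≡ v₁
  neighbour′-u₁ y u₁y with neighbour-u₁ y (G′⊆G u₁y)
  ... | inj₂ y≡v₁ = y≡v₁
  ... | inj₁ refl with trans (sym u₁y) (removeEdge-removes {G = G} {u₁} {u₂})
  ...   | ()

  outsideEdge : ∀ {x y} → Adj G x y → x ≢ u₁ → x ≢ u₂ → Adj G′ x y
  outsideEdge {x} {y} xy x≢u₁ x≢u₂ = removeEdge-keeps {G = G} {x = x} {y} xy
    λ { (inj₁ (x≡u₁ , _)) → x≢u₁ x≡u₁ ; (inj₂ (x≡u₂ , _)) → x≢u₂ x≡u₂ }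

reverse : ∀ {G} → Thread G → Thread G
reverse {G} t = record
  { u₁ = u₂ ; u₂ = u₁ ; v₁ = v₂ ; v₂ = v₁
  ; u₁~u₂ = adj-sym G u₁~u₂ ; u₁~v₁ = u₂~v₂ ; u₂~v₂ = u₁~v₁
  ; v₁≢u₂ = v₂≢u₁ ; v₂≢u₁ = v₁≢u₂ ; deg-u₁ = deg-u₂ ; deg-u₂ = deg-u₁
  }
  where open Thread t

module EndRecolouring {G : Graph} {ℓ k : ℕ} (t : Thread G) where
  open Thread t

  record Recoloured (c c′ : Colouring G ℓ k) (p q : Fin ℓ ⊎ Fin k) : Set where
    field
      at-u₁     : c′ u₁ ≡ p
      at-u₂     : c′ u₂ ≡ q
      elsewhere : ∀ x → x ≢ u₁ → x ≢ u₂ → c′ x ≡ c x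

  -- Conditions on the old colouring c under which u₁ may take p, when u₂ takes a colour other than p.
  record Admissible (c : Colouring G ℓ k) (p : Fin ℓ ⊎ Fin k) : Set where
    field
      ≢v₁       : p ≢ c v₁
      second≢v₂ : ∀ {β} → p ≡ inj₂ β → c v₂ ≢ inj₂ β
      second∉N  : ∀ {β} → p ≡ inj₂ β → ∀ y → Adj G v₁ y → y ≢ u₁ → y ≢ u₂ → c y ≢ inj₂ β

  admissible₁ : ∀ {c : Colouring G ℓ k} {a} → inj₁ a ≢ c v₁ → Admissible c (inj₁ a)
  admissible₁ ≢v₁ = record { ≢v₁ = ≢v₁ ; second≢v₂ = λ () ; second∉N = λ () }

  noConflictAt-u₁ : ∀ {c c′ p q} → Recoloured c c′ p q → p ≢ q → Admissible c p →
                    ∀ y → ¬ Conflict G c′ u₁ y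
  noConflictAt-u₁ {c} {c′} {p} {q} rc p≢q adm = noConflict
    where
    open Recoloured rc
    open Admissible adm
    c′v₁ : c′ v₁ ≡ c v₁
    c′v₁ = elsewhere v₁ v₁≢u₁ v₁≢u₂
    c′v₂ : c′ v₂ ≡ c v₂
    c′v₂ = elsewhere v₂ v₂≢u₁ v₂≢u₂

    noConflict : ∀ y → ¬ Conflict G c′ u₁ y
    noConflict y (adjacent u₁y same) with neighbour-u₁ y u₁y
    ... | inj₁ refl = p≢q (trans (sym at-u₁) (trans same at-u₂))
    ... | inj₂ refl = ≢v₁ (trans (sym at-u₁) (trans same c′v₁))
    noConflict y (commonNeighbour {w} u₁≢y u₁w wy c′u₁ c′y) with neighbour-u₁ w u₁w
    noConflict y (commonNeighbour {w} u₁≢y u₁w wy c′u₁ c′y) | inj₁ refl with neighbour-u₂ y wy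
    ... | inj₁ refl = u₁≢y refl
    ... | inj₂ refl = second≢v₂ (trans (sym at-u₁) c′u₁) (trans (sym c′v₂) c′y)
    noConflict y (commonNeighbour {w} u₁≢y u₁w wy c′u₁ c′y) | inj₂ refl with y ≟ u₂
    ... | yes refl = p≢q (trans (sym at-u₁) (trans c′u₁ (trans (sym c′y) at-u₂)))
    ... | no y≢u₂ = second∉N (trans (sym at-u₁) c′u₁) y wy (u₁≢y ∘ sym) y≢u₂
                      (trans (sym (elsewhere y (u₁≢y ∘ sym) y≢u₂)) c′y)

  restore : ∀ {c c′ : Colouring G ℓ k} → ConflictFree G′ c →
            (∀ x → x ≢ u₁ → x ≢ u₂ → c′ x ≡ c x) →
            (∀ y → ¬ Conflict G c′ u₁ y) → (∀ y → ¬ Conflict G c′ u₂ y) →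
            ConflictFree G c′
  restore {c} {c′} free agree free-u₁ free-u₂ x y conflict
    with x ≟ u₁ | x ≟ u₂ | y ≟ u₁ | y ≟ u₂
  ... | yes refl | _ | _ | _ = free-u₁ y conflict
  ... | _ | yes refl | _ | _ = free-u₂ y conflict
  ... | _ | _ | yes refl | _ = free-u₁ x (conflict-sym conflict)
  ... | _ | _ | _ | yes refl = free-u₂ x (conflict-sym conflict)
  ... | no x≢u₁ | no x≢u₂ | no y≢u₁ | no y≢u₂ = free x y (withoutEdge conflict)
    where
    agree-x : c′ x ≡ c x
    agree-x = agree x x≢u₁ x≢u₂
    agree-y : c′ y ≡ c y
    agree-y = agree y y≢u₁ y≢u₂

    middle∉ : ∀ {w} → x ≢ y → Adj G x w → Adj G w y → w ≢ u₁ × w ≢ u₂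
    middle∉ x≢y xw wy =
      (λ { refl → x≢y (deg≡2⇒≡ G deg-u₁ u₁~u₂ u₁~v₁ (v₁≢u₂ ∘ sym) (adj-sym G xw) wy x≢u₂ y≢u₂) }) ,
      (λ { refl → x≢y (deg≡2⇒≡ G deg-u₂ (adj-sym G u₁~u₂) u₂~v₂ (v₂≢u₁ ∘ sym) (adj-sym G xw) wy x≢u₁ y≢u₁) })

    withoutEdge : Conflict G c′ x y → Conflict G′ c x y
    withoutEdge (adjacent xy same) =
      adjacent (outsideEdge xy x≢u₁ x≢u₂) (trans (sym agree-x) (trans same agree-y))
    withoutEdge (commonNeighbour x≢y xw wy c′x c′y) with middle∉ x≢y xw wy
    ... | w≢u₁ , w≢u₂ = commonNeighbour x≢y (outsideEdge xw x≢u₁ x≢u₂) (outsideEdge wy w≢u₁ w≢u₂)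
                          (trans (sym agree-x) c′x) (trans (sym agree-y) c′y)

module _ {G : Graph} {ℓ k : ℕ} (t : Thread G) where
  open Thread t
  open EndRecolouring {ℓ = ℓ} {k} t
  private module Reversed = EndRecolouring {ℓ = ℓ} {k} (reverse t)

  recolour : ∀ {c : Colouring G ℓ k} → ConflictFree G′ c →
             (p q : Fin ℓ ⊎ Fin k) → p ≢ q → Admissible c p → Reversed.Admissible c q →
             HasPackingColoring G ℓ k
  recolour {c} free p q p≢q adm₁ adm₂ =
    c′ , conflictFree⇒packing (restore free elsewhere
           (noConflictAt-u₁ rc p≢q adm₁) (Reversed.noConflictAt-u₁ rc-reversed (p≢q ∘ sym) adm₂))
    where
    c′ : Colouring G ℓ k
    c′ = updateAt (updateAt c u₁ (const p)) u₂ (const q)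

    elsewhere : ∀ x → x ≢ u₁ → x ≢ u₂ → c′ x ≡ c x
    elsewhere x x≢u₁ x≢u₂ =
      trans (updateAt-minimal x u₂ _ x≢u₂) (updateAt-minimal x u₁ c x≢u₁)

    rc : Recoloured c c′ p q
    rc = record
      { at-u₁     = trans (updateAt-minimal u₁ u₂ _ u₁≢u₂) (updateAt-updates u₁ c)
      ; at-u₂     = updateAt-updates u₂ _
      ; elsewhere = elsewhere
      }

    rc-reversed : Reversed.Recoloured c c′ q p
    rc-reversed = record
      { at-u₁     = Recoloured.at-u₂ rc
      ; at-u₂     = Recoloured.at-u₁ rc
      ; elsewhere = λ x x≢u₂ x≢u₁ → elsewhere x x≢u₁ x≢u₂
      }

other : Fin 2 → Fin 2
other zero       = suc zero
other (suc zero) = zero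

other-≢ : ∀ a → other a ≢ a
other-≢ zero       ()
other-≢ (suc zero) ()

equalFirstsOrAvoidable : ∀ {k} (x y : Fin 2 ⊎ Fin k) →
  (∃ λ b → x ≡ inj₁ b × y ≡ inj₁ b) ⊎ (∃₂ λ a₁ a₂ → a₁ ≢ a₂ × inj₁ a₁ ≢ x × inj₁ a₂ ≢ y)
equalFirstsOrAvoidable (inj₁ b) (inj₁ b′) with b ≟ b′
... | yes refl = inj₁ (b , refl , refl)
... | no b≢b′  = inj₂ (b′ , b , b≢b′ ∘ sym , b≢b′ ∘ sym ∘ inj₁-injective , b≢b′ ∘ inj₁-injective)
equalFirstsOrAvoidable (inj₁ b) (inj₂ _) =
  inj₂ (other b , b , other-≢ b , other-≢ b ∘ inj₁-injective , λ ())
equalFirstsOrAvoidable (inj₂ _) (inj₁ b) =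
  inj₂ (b , other b , other-≢ b ∘ sym , (λ ()) , other-≢ b ∘ inj₁-injective)
equalFirstsOrAvoidable (inj₂ _) (inj₂ _) =
  inj₂ (zero , suc zero , (λ ()) , (λ ()) , λ ())

IsFirst : ∀ {ℓ k} → Fin ℓ ⊎ Fin k → Set
IsFirst x = ∃ λ a → x ≡ inj₁ a

isFirst? : ∀ {ℓ k} (x : Fin ℓ ⊎ Fin k) → Dec (IsFirst x)
isFirst? (inj₁ a) = yes (a , refl)
isFirst? (inj₂ _) = no λ { (_ , ()) }

module MinimalCounterexample {G : Graph} {k : ℕ} (t : Thread G)
  (uncolourable : ¬ HasPackingColoring G 2 k) (c : Colouring G 2 k)
  (free : ConflictFree (Thread.G′ t) c) where
  open Thread t
  open EndRecolouring {ℓ = 2} {k} t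
  private module Reversed = EndRecolouring {ℓ = 2} {k} (reverse t)

  firstColours-ends : ∀ a₁ a₂ → a₁ ≢ a₂ → inj₁ a₁ ≢ c v₁ → inj₁ a₂ ≢ c v₂ → ⊥
  firstColours-ends a₁ a₂ a₁≢a₂ ≢v₁ ≢v₂ = uncolourable
    (recolour t free (inj₁ a₁) (inj₁ a₂) (a₁≢a₂ ∘ inj₁-injective) (admissible₁ ≢v₁) (Reversed.admissible₁ ≢v₂))

  module SameFirstColour (b : Fin 2) (c-v₁ : c v₁ ≡ inj₁ b) (c-v₂ : c v₂ ≡ inj₁ b) where

    α : Fin 2
    α = other b

    α≢b : inj₁ {B = Fin k} α ≢ inj₁ b
    α≢b = other-≢ b ∘ inj₁-injective

    v₁-notSecond : ∀ {γ} → c v₁ ≢ inj₂ γ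
    v₁-notSecond eq with trans (sym c-v₁) eq
    ... | ()

    v₂-notSecond : ∀ {γ} → c v₂ ≢ inj₂ γ
    v₂-notSecond eq with trans (sym c-v₂) eq
    ... | ()

    UsedNear-v₁ : Fin k → Set
    UsedNear-v₁ γ = ∃ λ y → Adj G v₁ y × y ≢ u₁ × c y ≡ inj₂ γ

    usedNear-v₁? : ∀ γ → Dec (UsedNear-v₁ γ)
    usedNear-v₁? γ = any? λ y → (adj G v₁ y ≟ᵇ true) ×-dec ¬? (y ≟ u₁) ×-dec ≡-dec _≟_ _≟_ (c y) (inj₂ γ)

    unusedSecond : ∀ γ → ¬ UsedNear-v₁ γ → ⊥
    unusedSecond γ unused = uncolourable (recolour t free (inj₂ γ) (inj₁ α) (λ ()) admissible
      (Reversed.admissible₁ (α≢b ∘ flip trans c-v₂)))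
      where
      admissible : Admissible c (inj₂ γ)
      admissible = record
        { ≢v₁       = v₁-notSecond ∘ sym
        ; second≢v₂ = λ _ → v₂-notSecond
        ; second∉N  = λ { refl y v₁y y≢u₁ _ cy → unused (y , v₁y , y≢u₁ , cy) }
        }

    secondAt-u₂ : ∀ γ → c u₂ ≡ inj₂ γ → ⊥
    secondAt-u₂ γ c-u₂ = uncolourable (recolour t free (inj₁ α) (inj₂ γ) (λ ())
      (admissible₁ (α≢b ∘ flip trans c-v₁)) admissible)
      where
      u₂~v₂′ : Adj G′ u₂ v₂
      u₂~v₂′ = adj-sym G′ (outsideEdge (adj-sym G u₂~v₂) v₂≢u₁ v₂≢u₂)

      admissible : Reversed.Admissible c (inj₂ γ)
      admissible = record
        { ≢v₁       = v₂-notSecond ∘ sym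
        ; second≢v₂ = λ _ → v₁-notSecond
        ; second∉N  = λ { refl y v₂y y≢u₂ _ cy → free u₂ y
            (commonNeighbour (y≢u₂ ∘ sym) u₂~v₂′ (outsideEdge v₂y v₂≢u₁ v₂≢u₂) c-u₂ cy) }
        }

    countNeighbours : (∀ γ → UsedNear-v₁ γ) → ∀ w → Adj G v₁ w → w ≢ u₁ → IsFirst (c w) →
                      k + 2 ≤ deg G v₁
    countNeighbours used w v₁w w≢u₁ (a , c-w) =
      subst (_≤ deg G v₁) (+-comm 2 k) (injective⇒≤deg G v₁ (u₁ ∷ w ∷ g)
        (∷-injective (λ { zero → w≢u₁ ∘ sym ; (suc γ) → g≢u₁ γ ∘ sym })
          (∷-injective w≢g g-injective))
        λ { zero → adj-sym G u₁~v₁ ; (suc zero) → v₁w ; (suc (suc γ)) → proj₁ (proj₂ (used γ)) })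
      where
      g : Fin k → Vertex G
      g γ = proj₁ (used γ)

      g≢u₁ : ∀ γ → g γ ≢ u₁
      g≢u₁ γ = proj₁ (proj₂ (proj₂ (used γ)))

      c-g : ∀ γ → c (g γ) ≡ inj₂ γ
      c-g γ = proj₂ (proj₂ (proj₂ (used γ)))

      g-injective : Injective _≡_ _≡_ g
      g-injective {γ} {δ} eq = inj₂-injective (trans (sym (c-g γ)) (trans (cong c eq) (c-g δ)))

      w≢g : ∀ γ → w ≢ g γ
      w≢g γ eq with trans (sym c-w) (trans (cong c eq) (c-g γ))
      ... | ()

    shifted : Colouring G 2 k
    shifted = updateAt (updateAt c u₁ (const (inj₁ b))) v₁ (const (inj₁ α))

    shifted-v₁ : shifted v₁ ≡ inj₁ α
    shifted-v₁ = updateAt-updates v₁ _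

    shifted-u₁ : shifted u₁ ≡ inj₁ b
    shifted-u₁ = trans (updateAt-minimal u₁ v₁ _ (v₁≢u₁ ∘ sym)) (updateAt-updates u₁ c)

    shifted-elsewhere : ∀ x → x ≢ u₁ → x ≢ v₁ → shifted x ≡ c x
    shifted-elsewhere x x≢u₁ x≢v₁ =
      trans (updateAt-minimal x v₁ _ x≢v₁) (updateAt-minimal x u₁ c x≢u₁)

    shifted-conflictFree : (∀ y → Adj G v₁ y → y ≢ u₁ → ¬ IsFirst (c y)) → ConflictFree G′ shifted
    shifted-conflictFree nonFirst = conflictFree-recolour₁ free keepsSeconds properAtChanges
      where
      keepsSeconds : ∀ x {β} → shifted x ≡ inj₂ β → c x ≡ inj₂ β
      keepsSeconds x shifted-x with x ≟ u₁ | x ≟ v₁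
      ... | yes refl | _ with trans (sym shifted-u₁) shifted-x
      ...   | ()
      keepsSeconds x shifted-x | no _ | yes refl with trans (sym shifted-v₁) shifted-x
      ...   | ()
      keepsSeconds x shifted-x | no x≢u₁ | no x≢v₁ =
        trans (sym (shifted-elsewhere x x≢u₁ x≢v₁)) shifted-x

      properAtChanges : ∀ x y → shifted x ≢ c x → Adj G′ x y → shifted x ≢ shifted y
      properAtChanges x y moved xy = byVertex (x ≟ u₁) (x ≟ v₁) (y ≟ u₁)
        where
        byVertex : Dec (x ≡ u₁) → Dec (x ≡ v₁) → Dec (y ≡ u₁) → shifted x ≢ shifted y
        byVertex (yes refl) _ _ rewrite neighbour′-u₁ y xy =
          λ eq → α≢b (trans (sym shifted-v₁) (trans (sym eq) shifted-u₁))
        byVertex (no _) (yes refl) (yes refl) =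
          λ eq → α≢b (trans (sym shifted-v₁) (trans eq shifted-u₁))
        byVertex (no _) (yes refl) (no y≢u₁) = λ eq → nonFirst y (G′⊆G xy) y≢u₁
          (α , trans (sym (shifted-elsewhere y y≢u₁ (adj⇒≢ G (G′⊆G xy) ∘ sym))) (trans (sym eq) shifted-v₁))
        byVertex (no x≢u₁) (no x≢v₁) _ = ⊥-elim (moved (shifted-elsewhere x x≢u₁ x≢v₁))

    noFirstNear-v₁ : (∀ y → Adj G v₁ y → y ≢ u₁ → ¬ IsFirst (c y)) → ∀ a → c u₂ ≡ inj₁ a → ⊥
    noFirstNear-v₁ nonFirst a c-u₂ = uncolourable
      (recolour t (shifted-conflictFree nonFirst) (inj₁ b) (inj₁ α) (α≢b ∘ sym)
        (admissible₁ (λ eq → α≢b (trans (sym shifted-v₁) (sym eq))))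
        (Reversed.admissible₁ (λ eq → α≢b (trans eq (trans (shifted-elsewhere v₂ v₂≢u₁ v₂≢v₁) c-v₂)))))
      where
      v₂≢v₁ : v₂ ≢ v₁
      v₂≢v₁ refl = nonFirst u₂ (adj-sym G u₂~v₂) (u₁≢u₂ ∘ sym) (a , c-u₂)

    bound : k + 2 ≤ deg G v₁
    bound with all? usedNear-v₁?
    ... | no notAll = ⊥-elim (uncurry unusedSecond (¬∀⟶∃¬ k UsedNear-v₁ usedNear-v₁? notAll))
    ... | yes used with any? (λ y → (adj G v₁ y ≟ᵇ true) ×-dec ¬? (y ≟ u₁) ×-dec isFirst? (c y))
    ...   | yes (w , v₁w , w≢u₁ , first) = countNeighbours used w v₁w w≢u₁ first
    ...   | no noFirst with c u₂ in c-u₂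
    ...     | inj₂ γ = ⊥-elim (secondAt-u₂ γ c-u₂)
    ...     | inj₁ a = ⊥-elim (noFirstNear-v₁ (λ y v₁y y≢u₁ first → noFirst (y , v₁y , y≢u₁ , first)) a c-u₂)

  deg-v₁ : k + 2 ≤ deg G v₁
  deg-v₁ with equalFirstsOrAvoidable (c v₁) (c v₂)
  ... | inj₁ (b , c-v₁ , c-v₂) = SameFirstColour.bound b c-v₁ c-v₂
  ... | inj₂ (a₁ , a₂ , a₁≢a₂ , ≢v₁ , ≢v₂) = ⊥-elim (firstColours-ends a₁ a₂ a₁≢a₂ ≢v₁ ≢v₂)

largeDegree-v₁ : ∀ {G k} (t : Thread G) → ¬ HasPackingColoring G 2 k →
                 (∀ H → IsProperSubgraph H G → HasPackingColoring H 2 k) →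
                 k + 2 ≤ deg G (Thread.v₁ t)
largeDegree-v₁ {G} t uncolourable minimal
  with minimal _ (removeEdge-proper {G = G} (Thread.u₁~u₂ t))
... | c , packing = MinimalCounterexample.deg-v₁ t uncolourable c (packing⇒conflictFree packing)

lemma3p2 : (k : ℕ) → 1 ≤ k → (G : Graph)
           → ¬ HasPackingColoring G 2 k
           → (∀ (H : Graph) → IsProperSubgraph H G → HasPackingColoring H 2 k)
           → (u₁ u₂ v₁ v₂ : Vertex G)
           → Adj G u₁ u₂ → deg G u₁ ≡ 2 → deg G u₂ ≡ 2
           → Adj G u₁ v₁ → v₁ ≢ u₂ → Adj G u₂ v₂ → v₂ ≢ u₁
           → (k + 2 ≤ deg G v₁) × (k + 2 ≤ deg G v₂)
lemma3p2 k _ G uncolourable minimal u₁ u₂ v₁ v₂ u₁~u₂ deg-u₁ deg-u₂ u₁~v₁ v₁≢u₂ u₂~v₂ v₂≢u₁ =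
  largeDegree-v₁ thread uncolourable minimal , largeDegree-v₁ (reverse thread) uncolourable minimal
  where
  thread : Thread G
  thread = record
    { u₁ = u₁ ; u₂ = u₂ ; v₁ = v₁ ; v₂ = v₂
    ; u₁~u₂ = u₁~u₂ ; u₁~v₁ = u₁~v₁ ; u₂~v₂ = u₂~v₂
    ; v₁≢u₂ = v₁≢u₂ ; v₂≢u₁ = v₂≢u₁ ; deg-u₁ = deg-u₁ ; deg-u₂ = deg-u₂
    }
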